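{- If $G$ is a (claw, net)-free graph, then every linear coloring of $G$ is a centered coloring. In particular, $\chi_{\mathrm{lin}}(G)=\chi_{\mathrm{cen}}(G)$.
   Context: All graphs are finite and simple. The claw is the graph obtained by attaching 3 pendant vertices to a single vertex; the net is the graph obtained by attaching one pendant vertex to each vertex of a triangle $K_3$. $G$ is (claw, net)-free if no induced subgraph of $G$ is isomorphic to the claw or the net. A centered coloring of $G$ assigns integers (colors) to vertices so that every connected subgraph contains a vertex whose color is unique in that subgraph; $\chi_{\mathrm{cen}}(G)$ is the minimum number of colors of such a coloring. A linear coloring requires the same only for every path of $G$ (as a subgraph); $\chi_{\mathrm{lin}}(G)$ is the minimum number of colors of a linear coloring. -}

module Defs where

open import Data.Nat using (ℕ; zero; suc; _≤_)
open import Data.Fin using (Fin; zero; suc; toℕ)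
open import Data.Bool using (Bool; true; false)
open import Data.List using (List; []; _∷_)
open import Data.List.Membership.Propositional using (_∈_)
open import Data.List.Relation.Unary.Unique.Propositional using (Unique)
open import Data.List.Relation.Unary.Linked using (Linked)
open import Data.Product using (Σ; ∃; _×_; _,_)
open import Function.Definitions using (Injective)
open import Data.Empty using (⊥)
open import Relation.Binary.PropositionalEquality using (_≡_; _≢_)

record Graph : Set where
  field
    n       : ℕ
    adj     : Fin n → Fin n → Bool
    sym     : ∀ u v → adj u v ≡ adj v u
    irrefl  : ∀ u → adj u u ≡ false

open Graph public

Vertex : Graph → Set
Vertex G = Fin (n G)

Adj : (G : Graph) → Vertex G → Vertex G → Set
Adj G u v = adj G u v ≡ true

HasInduced : (G : Graph) (k : ℕ) → (Fin k → Fin k → Bool) → Set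
HasInduced G k H =
  Σ (Fin k → Vertex G) λ f →
    Injective _≡_ _≡_ f × (∀ i j → adj G (f i) (f j) ≡ H i j)

clawAdj : Fin 4 → Fin 4 → Bool
clawAdj zero zero       = false
clawAdj zero (suc _)    = true
clawAdj (suc _) zero    = true
clawAdj (suc _) (suc _) = false

-- net: triangle 0,1,2 with pendant vertices 3-0, 4-1, 5-2
netE : ℕ → ℕ → Bool
netE 0 1 = true
netE 1 0 = true
netE 1 2 = true
netE 2 1 = true
netE 0 2 = true
netE 2 0 = true
netE 0 3 = true
netE 3 0 = true
netE 1 4 = true
netE 4 1 = true
netE 2 5 = true
netE 5 2 = true
netE _ _ = false

netAdj : Fin 6 → Fin 6 → Bool
netAdj i j = netE (toℕ i) (toℕ j)

ClawNetFree : Graph → Set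
ClawNetFree G = (HasInduced G 4 clawAdj → ⊥) × (HasInduced G 6 netAdj → ⊥)

record Subgraph (G : Graph) : Set where
  field
    S      : Vertex G → Bool
    F      : Vertex G → Vertex G → Bool
    F⊆E    : ∀ u v → F u v ≡ true → Adj G u v
    F-sym  : ∀ u v → F u v ≡ F v u
    F-endˡ : ∀ u v → F u v ≡ true → S u ≡ true

open Subgraph public

data Walk {G : Graph} (H : Subgraph G) : Vertex G → Vertex G → Set where
  here : ∀ {u} → Walk H u u
  step : ∀ {u v w} → F H u v ≡ true → Walk H v w → Walk H u w

Connected : {G : Graph} → Subgraph G → Set
Connected {G} H =
  (∃ λ v → S H v ≡ true) ×
  (∀ u v → S H u ≡ true → S H v ≡ true → Walk H u v)

HasUniqueColorSub : {G : Graph} {C : Set} → (Vertex G → C) → Subgraph G → Set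
HasUniqueColorSub {G} c H =
  ∃ λ v → S H v ≡ true × (∀ w → S H w ≡ true → c w ≡ c v → w ≡ v)

IsCentered : (G : Graph) {C : Set} → (Vertex G → C) → Set
IsCentered G {C} c = (H : Subgraph G) → Connected H → HasUniqueColorSub {G} {C} c H

IsPath : (G : Graph) → List (Vertex G) → Set
IsPath G []       = ⊥
IsPath G (x ∷ xs) = Unique (x ∷ xs) × Linked (Adj G) (x ∷ xs)

HasUniqueColorList : {G : Graph} {C : Set} → (Vertex G → C) → List (Vertex G) → Set
HasUniqueColorList {G} c P =
  ∃ λ (v : Vertex G) → v ∈ P × (∀ w → w ∈ P → c w ≡ c v → w ≡ v)

IsLinear : (G : Graph) {C : Set} → (Vertex G → C) → Set
IsLinear G {C} c = (P : List (Vertex G)) → IsPath G P → HasUniqueColorList {G} {C} c P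

IsChiLin : Graph → ℕ → Set
IsChiLin G k =
  (Σ (Vertex G → Fin k) λ c → IsLinear G c) ×
  (∀ m → (c : Vertex G → Fin m) → IsLinear G c → k ≤ m)

IsChiCen : Graph → ℕ → Set
IsChiCen G k =
  (Σ (Vertex G → Fin k) λ c → IsCentered G c) ×
  (∀ m → (c : Vertex G → Fin m) → IsCentered G c → k ≤ m)

{-# OPTIONS --safe #-}
-- A path of G is a connected subgraph, so centered colorings are linear.
-- Conversely, a connected vertex set X of a (claw, net)-free graph carries a
-- Hamiltonian path of G[X], and a color occurring once on that path occurs once
-- on X.
--
-- An induced path v₀ v₁ … vᵣ in X that cannot be lengthened is dominated by
-- v₁ … vᵣ: otherwise a walk in X leaves the closed neighbourhood of the path
-- along an edge y u, and a neighbour of y in the interior of the path would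
-- produce a claw or a net, so y sees an end of the path and u y can be attached
-- there. From such a path a Hamiltonian path starting at v₀ is built by
-- induction on |X|: delete v₀ and restart at v₁, or at a neighbour y of v₁
-- that sees nothing further along the path. A claw at v₁ forces y ~ v₀, unless
-- r = 1, and then v₀ v₁ y is again a dominating induced path.
module Submission where

open import Defs
open import Data.Bool using (Bool; true; false; _∧_)
open import Data.Bool.Properties using (¬-not; not-¬; T-≡) renaming (_≟_ to _≟ᵇ_)
open import Data.Empty using (⊥; ⊥-elim)
open import Data.Fin using (Fin; zero; suc; _≟_)
open import Data.Fin.Properties using (any?; all?)
open import Data.Fin.Subset using (Subset; ∣_∣; ⁅_⁆; _-_) renaming (_∈_ to _∈ₛ_; _∉_ to _∉ₛ_)
open import Data.Fin.Subset.Properties using (x∈p⇒∣p-x∣<∣p∣; x∈p∧x≢y⇒x∈p-y; p─q⊆p)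
  renaming (_∈?_ to _∈ₛ?_)
open import Data.List using (List; []; _∷_; length; reverse; _∷ʳ_; allFin)
open import Data.List.Properties using (unfold-reverse; length-reverse)
open import Data.List.Membership.Propositional using (_∈_; _∉_; lose; find)
open import Data.List.Membership.Propositional.Properties using (∈-allFin)
open import Data.List.Relation.Unary.All as All using (All; []; _∷_)
open import Data.List.Relation.Unary.All.Properties using (∷ʳ⁺)
open import Data.List.Relation.Unary.Any as Any using (Any; here; there)
open import Data.List.Relation.Unary.Any.Properties using (reverse⁻; ++⁺ˡ)
open import Data.List.Relation.Unary.AllPairs using ([]; _∷_)
open import Data.List.Relation.Unary.Unique.Propositional using (Unique)
open import Data.List.Relation.Unary.Linked using (Linked; []; [-]; _∷_)
open import Data.Nat using (ℕ; zero; suc; _≤_; _<_; _∸_; z≤n; s≤s)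
open import Data.Nat.Induction using (<-wellFounded)
open import Data.Nat.Properties using (≤-refl; ≤-trans; n≤1+n; ∸-monoʳ-<)
open import Data.Product using (∃; ∃₂; _×_; _,_; proj₁; proj₂)
open import Data.Sum using (_⊎_; inj₁; inj₂; [_,_]′)
open import Data.Unit using (⊤; tt)
open import Data.Vec as Vec using (tabulate; lookup)
open import Data.Vec.Properties using (lookup∘tabulate; lookup⇒[]=; []=⇒lookup)
open import Function using (_∘_; _on_; id)
open import Function.Bundles using (_⇔_; mk⇔; Equivalence)
open import Function.Definitions using (Injective)
open import Induction.WellFounded using (Acc; acc)
open import Relation.Nullary using (¬_; Dec; yes; no; isYes)
open import Relation.Nullary.Decidable using (_×-dec_; _⊎-dec_; ¬?; decidable-stable; from-yes; toWitness; fromWitness)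
open import Relation.Unary using (Decidable)
open import Relation.Binary.PropositionalEquality as ≡ using (_≡_; _≢_; refl; subst; cong; ≢-sym)

open Equivalence using (to; from)

x∉p-x : ∀ {m} {p : Subset m} (x : Fin m) → x ∉ₛ p - x
x∉p-x {p = _ Vec.∷ _} zero ()
x∉p-x {p = _ Vec.∷ _} (suc x) (Vec.there x∈p-x) = x∉p-x x x∈p-x

x∈p-y⇒x≢y : ∀ {m} {p : Subset m} {x y : Fin m} → x ∈ₛ p - y → x ≢ y
x∈p-y⇒x≢y x∈p-x refl = x∉p-x _ x∈p-x

x∈p-y⇒x∈p : ∀ {m} {p : Subset m} {x y : Fin m} → x ∈ₛ p - y → x ∈ₛ p
x∈p-y⇒x∈p {p = p} {y = y} = p─q⊆p p ⁅ y ⁆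

All∈p-x : ∀ {m} {p : Subset m} {x} {xs : List (Fin m)} → All (_∈ₛ p) xs → All (x ≢_) xs → All (_∈ₛ p - x) xs
All∈p-x xs⊆p x∉xs = All.zipWith (λ (y∈p , x≢y) → x∈p∧x≢y⇒x∈p-y y∈p (≢-sym x≢y)) (xs⊆p , x∉xs)

length≤∣p∣ : ∀ {m} {p : Subset m} {xs : List (Fin m)} → Unique xs → All (_∈ₛ p) xs → length xs ≤ ∣ p ∣
length≤∣p∣ []              []          = z≤n
length≤∣p∣ (x∉xs ∷ unique) (x∈p ∷ xs⊆p) =
  ≤-trans (s≤s (length≤∣p∣ unique (All∈p-x xs⊆p x∉xs))) (x∈p⇒∣p-x∣<∣p∣ x∈p)

∈-tabulate⁺ : ∀ {m} {f : Fin m → Bool} {x} → f x ≡ true → x ∈ₛ tabulate f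
∈-tabulate⁺ {f = f} {x} fx = lookup⇒[]= x (tabulate f) (≡.trans (lookup∘tabulate f x) fx)

∈-tabulate⁻ : ∀ {m} {f : Fin m → Bool} {x} → x ∈ₛ tabulate f → f x ≡ true
∈-tabulate⁻ {f = f} {x} x∈ = ≡.trans (≡.sym (lookup∘tabulate f x)) ([]=⇒lookup x∈)

module _ {G : Graph} where

  private
    V : Set
    V = Vertex G

  open import Data.List.Membership.DecPropositional (_≟_ {n G}) using (_∈?_)

  infix 4 _~_ _~?_

  _~_ : V → V → Set
  _~_ = Adj G

  _~?_ : ∀ u v → Dec (u ~ v)
  u ~? v = adj G u v ≟ᵇ true

  ~-sym : ∀ {u v} → u ~ v → v ~ u
  ~-sym {u} {v} u~v = ≡.trans (sym G v u) u~v

  ~⇒≢ : ∀ {u v} → u ~ v → u ≢ v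
  ~⇒≢ {u} u~u refl = not-¬ (irrefl G u) u~u

  Apart : V → V → Set
  Apart u v = u ≢ v × ¬ u ~ v

  Apart-sym : ∀ {u v} → Apart u v → Apart v u
  Apart-sym (u≢v , u≁v) = ≢-sym u≢v , u≁v ∘ ~-sym

  -- Non-edges of a pattern also demand distinct ends, which makes embeddings injective.
  _~[_]_ : V → Bool → V → Set
  u ~[ true  ] v = u ~ v
  u ~[ false ] v = Apart u v

  ~[]⇒≢ : ∀ {u v} b → u ~[ b ] v → u ≢ v
  ~[]⇒≢ true  = ~⇒≢
  ~[]⇒≢ false = proj₁

  ~[]⇒adj≡ : ∀ {u v} b → u ~[ b ] v → adj G u v ≡ b
  ~[]⇒adj≡ true  u~v       = u~v
  ~[]⇒adj≡ false (_ , u≁v) = ¬-not u≁v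

  InducedCopy : ∀ {k} → (Fin k → V) → (Fin k → Fin k → Bool) → Set
  InducedCopy {zero}  f H = ⊤
  InducedCopy {suc k} f H =
    All (λ j → f zero ~[ H zero (suc j) ] f (suc j)) (allFin k) × InducedCopy (f ∘ suc) (H on suc)

  InducedCopy⇒injective : ∀ {k} {f : Fin k → V} {H} → InducedCopy f H → Injective _≡_ _≡_ f
  InducedCopy⇒injective _ {zero} {zero} _ = refl
  InducedCopy⇒injective {H = H} (row , _) {zero} {suc j} f0≡fj =
    ⊥-elim (~[]⇒≢ (H zero (suc j)) (All.lookup row (∈-allFin j)) f0≡fj)
  InducedCopy⇒injective {H = H} (row , _) {suc i} {zero} fi≡f0 =
    ⊥-elim (~[]⇒≢ (H zero (suc i)) (All.lookup row (∈-allFin i)) (≡.sym fi≡f0))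
  InducedCopy⇒injective (_ , rest) {suc i} {suc j} fi≡fj = cong suc (InducedCopy⇒injective rest fi≡fj)

  InducedCopy⇒adj≡ : ∀ {k} {f : Fin k → V} {H} → (∀ i j → H i j ≡ H j i) → (∀ i → H i i ≡ false) →
                     InducedCopy f H → ∀ i j → adj G (f i) (f j) ≡ H i j
  InducedCopy⇒adj≡ {f = f} H-sym H-irrefl _ zero zero = ≡.trans (irrefl G (f zero)) (≡.sym (H-irrefl zero))
  InducedCopy⇒adj≡ {H = H} H-sym H-irrefl (row , _) zero (suc j) =
    ~[]⇒adj≡ (H zero (suc j)) (All.lookup row (∈-allFin j))
  InducedCopy⇒adj≡ {f = f} {H} H-sym H-irrefl (row , _) (suc i) zero =
    ≡.trans (sym G (f (suc i)) (f zero))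
            (≡.trans (~[]⇒adj≡ (H zero (suc i)) (All.lookup row (∈-allFin i))) (H-sym zero (suc i)))
  InducedCopy⇒adj≡ H-sym H-irrefl (_ , rest) (suc i) (suc j) =
    InducedCopy⇒adj≡ (λ i j → H-sym (suc i) (suc j)) (H-irrefl ∘ suc) rest i j

  InducedCopy⇒HasInduced : ∀ {k} {f : Fin k → V} {H} → (∀ i j → H i j ≡ H j i) → (∀ i → H i i ≡ false) →
                           InducedCopy f H → HasInduced G k H
  InducedCopy⇒HasInduced {f = f} H-sym H-irrefl copy =
    f , InducedCopy⇒injective copy , InducedCopy⇒adj≡ H-sym H-irrefl copy

  module _ {H : Subgraph G} where

    _++ʷ_ : ∀ {u v w} → Walk H u v → Walk H v w → Walk H u w
    here     ++ʷ q = q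
    step e p ++ʷ q = step e (p ++ʷ q)

    reverseʷ : ∀ {u v} → Walk H u v → Walk H v u
    reverseʷ here               = here
    reverseʷ (step {u} {v} e p) = reverseʷ p ++ʷ step (≡.trans (F-sym H v u) e) here

    walk-leaves : ∀ {D : V → Set} {a b} → Decidable D → Walk H a b → D a → ¬ D b →
                  ∃₂ λ a′ b′ → F H a′ b′ ≡ true × D a′ × ¬ D b′
    walk-leaves D? here               Da ¬Db = ⊥-elim (¬Db Da)
    walk-leaves D? (step {u} {v} e p) Du ¬Db with D? v
    ... | yes Dv  = walk-leaves D? p Dv ¬Db
    ... | no  ¬Dv = u , v , e , Du , ¬Dv

  CutConnected : Subset (n G) → Set₁
  CutConnected X = ∀ {D : V → Set} → Decidable D → ∀ {a b} → a ∈ₛ X → b ∈ₛ X → D a → ¬ D b →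
                   ∃₂ λ a′ b′ → a′ ∈ₛ X × b′ ∈ₛ X × a′ ~ b′ × D a′ × ¬ D b′

  Connected⇒CutConnected : (H : Subgraph G) → Connected H → CutConnected (tabulate (S H))
  Connected⇒CutConnected H (_ , walk) D? a∈X b∈X Da ¬Db =
    let a′ , b′ , e , Da′ , ¬Db′ = walk-leaves D? (walk _ _ (∈-tabulate⁻ a∈X) (∈-tabulate⁻ b∈X)) Da ¬Db
    in  a′ , b′ , ∈-tabulate⁺ (F-endˡ H a′ b′ e) , ∈-tabulate⁺ (F-endˡ H b′ a′ (≡.trans (F-sym H b′ a′) e)) ,
        F⊆E H a′ b′ e , Da′ , ¬Db′

  induced : (V → Bool) → Subgraph G
  induced X = record { S = X ; F = F′ ; F⊆E = F′⊆E ; F-sym = F′-sym ; F-endˡ = F′-endˡ }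
    where
    F′ : V → V → Bool
    F′ u v = X u ∧ (X v ∧ adj G u v)

    F′⊆E : ∀ u v → F′ u v ≡ true → u ~ v
    F′⊆E u v e with X u | X v
    ... | true | true = e

    F′-sym : ∀ u v → F′ u v ≡ F′ v u
    F′-sym u v with X u | X v
    ... | true  | true  = sym G u v
    ... | true  | false = refl
    ... | false | true  = refl
    ... | false | false = refl

    F′-endˡ : ∀ u v → F′ u v ≡ true → X u ≡ true
    F′-endˡ u v e with X u
    ... | true = refl

  induced-edge : ∀ {X u v} → X u ≡ true → X v ≡ true → u ~ v → F (induced X) u v ≡ true
  induced-edge Xu Xv u~v rewrite Xu | Xv = u~v

  walk-along : ∀ {X x xs y} → Linked _~_ (x ∷ xs) → All (λ z → X z ≡ true) (x ∷ xs) → y ∈ x ∷ xs →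
               Walk (induced X) x y
  walk-along _               _                (here refl) = here
  walk-along (x~x′ ∷ linked) (Xx ∷ Xx′ ∷ Xxs) (there y∈)  =
    step (induced-edge Xx Xx′ x~x′) (walk-along linked (Xx′ ∷ Xxs) y∈)

  Attaches : V → List V → Set
  Attaches x []       = ⊤
  Attaches x (y ∷ ys) = x ~ y × All (Apart x) ys

  InducedPath : List V → Set
  InducedPath []       = ⊤
  InducedPath (x ∷ xs) = Attaches x xs × InducedPath xs

  Attaches⇒≢ : ∀ {x} xs → Attaches x xs → All (x ≢_) xs
  Attaches⇒≢ []       _             = []
  Attaches⇒≢ (y ∷ ys) (x~y , x⊥ys) = ~⇒≢ x~y ∷ All.map proj₁ x⊥ys

  InducedPath⇒Unique : ∀ xs → InducedPath xs → Unique xs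
  InducedPath⇒Unique []       _        = []
  InducedPath⇒Unique (x ∷ xs) (x◃ , p) = Attaches⇒≢ xs x◃ ∷ InducedPath⇒Unique xs p

  AttachesEnd : List V → V → Set
  AttachesEnd []           x = ⊤
  AttachesEnd (y ∷ [])     x = y ~ x
  AttachesEnd (y ∷ z ∷ zs) x = Apart y x × AttachesEnd (z ∷ zs) x

  InducedPath-∷ʳ : ∀ {x} xs → InducedPath xs → AttachesEnd xs x → InducedPath (xs ∷ʳ x)
  InducedPath-∷ʳ []           _                   _           = tt , tt
  InducedPath-∷ʳ (y ∷ [])     _                   y~x         = (y~x , []) , tt , tt
  InducedPath-∷ʳ (y ∷ z ∷ zs) ((y~z , y⊥zs) , p) (y⊥x , ▹x) = (y~z , ∷ʳ⁺ y⊥zs y⊥x) , InducedPath-∷ʳ (z ∷ zs) p ▹x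

  AttachesEnd-∷ʳ : ∀ {x y} zs → All (λ z → Apart z x) zs → y ~ x → AttachesEnd (zs ∷ʳ y) x
  AttachesEnd-∷ʳ []            []               y~x = y~x
  AttachesEnd-∷ʳ (z ∷ [])      (z⊥x ∷ [])       y~x = z⊥x , y~x
  AttachesEnd-∷ʳ (z ∷ z′ ∷ zs) (z⊥x ∷ z′zs⊥x)   y~x = z⊥x , AttachesEnd-∷ʳ (z′ ∷ zs) z′zs⊥x y~x

  All-reverse : ∀ {P : V → Set} {xs} → All P xs → All P (reverse xs)
  All-reverse Pxs = All.tabulate (All.lookup Pxs ∘ reverse⁻)

  Attaches⇒AttachesEnd-reverse : ∀ {x} xs → Attaches x xs → AttachesEnd (reverse xs) x
  Attaches⇒AttachesEnd-reverse     []       _            = tt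
  Attaches⇒AttachesEnd-reverse {x} (y ∷ ys) (x~y , x⊥ys) =
    subst (λ zs → AttachesEnd zs x) (≡.sym (unfold-reverse y ys))
          (AttachesEnd-∷ʳ (reverse ys) (All-reverse (All.map Apart-sym x⊥ys)) (~-sym x~y))

  InducedPath-reverse : ∀ xs → InducedPath xs → InducedPath (reverse xs)
  InducedPath-reverse []       _        = tt
  InducedPath-reverse (x ∷ xs) (x◃ , p) =
    subst InducedPath (≡.sym (unfold-reverse x xs))
          (InducedPath-∷ʳ (reverse xs) (InducedPath-reverse xs p) (Attaches⇒AttachesEnd-reverse xs x◃))

  ∉-∷ : ∀ {z v : V} {xs} → z ≢ v → z ∉ xs → z ∉ v ∷ xs
  ∉-∷ z≢v z∉xs = [ z≢v , z∉xs ]′ ∘ Any.toSum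

  ∉∧≁⇒Apart : ∀ {y x xs} → y ∉ xs → x ∈ xs → ¬ y ~ x → Apart y x
  ∉∧≁⇒Apart y∉xs x∈xs y≁x = (λ { refl → y∉xs x∈xs }) , y≁x

  apart-all : ∀ {y xs} → y ∉ xs → ¬ Any (y ~_) xs → All (Apart y) xs
  apart-all y∉xs y≁xs = All.tabulate λ x∈xs → ∉∧≁⇒Apart y∉xs x∈xs (y≁xs ∘ lose x∈xs)

  -- Hamiltonian paths from dominating induced paths

  InducedPathIn : Subset (n G) → List V → Set
  InducedPathIn X P = InducedPath P × All (_∈ₛ X) P

  TailDominates : Subset (n G) → V → List V → Set
  TailDominates X v₀ ps = ∀ {z} → z ∈ₛ X → z ∉ v₀ ∷ ps → Any (z ~_) ps

  DominatingPath : Subset (n G) → V → List V → Set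
  DominatingPath X v₀ ps = InducedPathIn X (v₀ ∷ ps) × TailDominates X v₀ ps

  HamiltonianPathFrom : Subset (n G) → V → Set
  HamiltonianPathFrom X v = ∃ λ Q → IsPath G (v ∷ Q) × (∀ {z} → z ∈ v ∷ Q ⇔ z ∈ₛ X)

  PrivateNeighbour : Subset (n G) → V → V → List V → V → Set
  PrivateNeighbour X v₀ v₁ ps y = y ∈ₛ X × y ∉ v₀ ∷ v₁ ∷ ps × y ~ v₁ × ¬ Any (y ~_) ps

  privateNeighbour? : ∀ X v₀ v₁ ps → Decidable (PrivateNeighbour X v₀ v₁ ps)
  privateNeighbour? X v₀ v₁ ps y =
    (y ∈ₛ? X) ×-dec ¬? (y ∈? (v₀ ∷ v₁ ∷ ps)) ×-dec (y ~? v₁) ×-dec ¬? (Any.any? (y ~?_) ps)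

  drop-start : ∀ {X v₀ v₁ ps} → DominatingPath X v₀ (v₁ ∷ ps) → (∀ y → ¬ PrivateNeighbour X v₀ v₁ ps y) →
               DominatingPath (X - v₀) v₁ ps
  drop-start {X} {v₀} {v₁} {ps} (((v₀◃ , path) , _ ∷ inX) , dom) none =
    (path , All∈p-x inX (Attaches⇒≢ (v₁ ∷ ps) v₀◃)) , dom′
    where
    dom′ : TailDominates (X - v₀) v₁ ps
    dom′ {z} z∈X-v₀ z∉ = decidable-stable (Any.any? (z ~?_) ps) λ z≁ps →
      none z (z∈X , z∉′ , Any.head z≁ps (dom z∈X z∉′) , z≁ps)
      where
      z∈X = x∈p-y⇒x∈p z∈X-v₀
      z∉′ = ∉-∷ (x∈p-y⇒x≢y z∈X-v₀) z∉

  replace-start : ∀ {X v₀ v₁ ps y} → DominatingPath X v₀ (v₁ ∷ ps) → PrivateNeighbour X v₀ v₁ ps y →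
                  DominatingPath (X - v₀) y (v₁ ∷ ps)
  replace-start {X} {v₀} {v₁} {ps} {y} (((v₀◃ , path) , _ ∷ inX) , dom) (y∈X , y∉ , y~v₁ , y≁ps) =
    ( ((y~v₁ , apart-all (y∉ ∘ there ∘ there) y≁ps) , path)
    , All∈p-x (y∈X ∷ inX) (≢-sym (y∉ ∘ here) ∷ Attaches⇒≢ (v₁ ∷ ps) v₀◃))
    , λ z∈X-v₀ z∉ → dom (x∈p-y⇒x∈p z∈X-v₀) (∉-∷ (x∈p-y⇒x≢y z∈X-v₀) (z∉ ∘ there))

  extend-short : ∀ {X v₀ v₁ y} → DominatingPath X v₀ (v₁ ∷ []) → PrivateNeighbour X v₀ v₁ [] y → ¬ y ~ v₀ →
                 DominatingPath X v₀ (v₁ ∷ y ∷ [])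
  extend-short (((v₀◃ , _) , v₀∈X ∷ v₁∈X ∷ []) , dom) (y∈X , y∉ , y~v₁ , _) y≁v₀ =
    ( ((proj₁ v₀◃ , Apart-sym (∉∧≁⇒Apart y∉ (here refl) y≁v₀) ∷ []) , (~-sym y~v₁ , []) , tt , tt)
    , v₀∈X ∷ v₁∈X ∷ y∈X ∷ [])
    , λ z∈X z∉ → ++⁺ˡ (dom z∈X (z∉ ∘ ++⁺ˡ))

  trivial-hamiltonian : ∀ {X v₀} → DominatingPath X v₀ [] → HamiltonianPathFrom X v₀
  trivial-hamiltonian {X} {v₀} ((_ , v₀∈X ∷ []) , dom) = [] , ([] ∷ [] , [-]) , mk⇔ (λ { (here refl) → v₀∈X }) only-v₀
    where
    only-v₀ : ∀ {z} → z ∈ₛ X → z ∈ v₀ ∷ []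
    only-v₀ {z} z∈X with z ≟ v₀
    ... | yes z≡v₀ = here z≡v₀
    ... | no  z≢v₀ with () ← dom z∈X (∉-∷ z≢v₀ λ ())

  prepend : ∀ {X v w} → v ~ w → v ∈ₛ X → HamiltonianPathFrom (X - v) w → HamiltonianPathFrom X v
  prepend {X} {v} {w} v~w v∈X (Q , (unique , linked) , spans) =
    w ∷ Q , (All.tabulate (λ z∈ → ≢-sym (x∈p-y⇒x≢y (to spans z∈))) ∷ unique , v~w ∷ linked) , mk⇔ to′ from′
    where
    to′ : ∀ {z} → z ∈ v ∷ w ∷ Q → z ∈ₛ X
    to′ (here refl) = v∈X
    to′ (there z∈)  = x∈p-y⇒x∈p (to spans z∈)

    from′ : ∀ {z} → z ∈ₛ X → z ∈ v ∷ w ∷ Q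
    from′ {z} z∈X with z ≟ v
    ... | yes z≡v = here z≡v
    ... | no  z≢v = there (from spans (x∈p∧x≢y⇒x∈p-y z∈X z≢v))

  NextStart : Subset (n G) → V → Set
  NextStart X v₀ = ∃₂ λ w ws → v₀ ~ w × DominatingPath (X - v₀) w ws

  start-or-private : ∀ {X v₀ v₁ ps} → DominatingPath X v₀ (v₁ ∷ ps) →
                     NextStart X v₀ ⊎ ∃ λ y → PrivateNeighbour X v₀ v₁ ps y × ¬ y ~ v₀
  start-or-private {X} {v₀} {v₁} {ps} dp@((((v₀~v₁ , _) , _) , _) , _)
    with any? (privateNeighbour? X v₀ v₁ ps)
  ... | no none = inj₁ (v₁ , ps , v₀~v₁ , drop-start dp λ y py → none (y , py))
  ... | yes (y , py) with y ~? v₀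
  ...   | yes y~v₀ = inj₁ (y , v₁ ∷ ps , ~-sym y~v₀ , replace-start dp py)
  ...   | no  y≁v₀ = inj₂ (y , py , y≁v₀)

  -- Lengthening induced paths

  infix 4 _~head_

  _~head_ : V → List V → Set
  y ~head []      = ⊥
  y ~head (x ∷ _) = y ~ x

  ~head-∷ʳ : ∀ {y x} xs → y ~head xs → y ~head (xs ∷ʳ x)
  ~head-∷ʳ (_ ∷ _) y~x = y~x

  N[_] : List V → V → Set
  N[ P ] z = z ∈ P ⊎ Any (z ~_) P

  N[_]? : ∀ P → Decidable N[ P ]
  N[ P ]? z = (z ∈? P) ⊎-dec Any.any? (z ~?_) P

  Escape : V → V → List V → Set
  Escape y u P = y ∉ P × u ~ y × All (Apart u) P

  Escape-tail : ∀ {y u p ps} → Escape y u (p ∷ ps) → Escape y u ps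
  Escape-tail (y∉ , u~y , _ ∷ u⊥ps) = y∉ ∘ there , u~y , u⊥ps

  Escape-reverse : ∀ {y u P} → Escape y u P → Escape y u (reverse P)
  Escape-reverse (y∉ , u~y , u⊥P) = y∉ ∘ reverse⁻ , u~y , All-reverse u⊥P

  Longer : Subset (n G) → ℕ → Set
  Longer X ℓ = ∃ λ Q → InducedPathIn X Q × ℓ < length Q

  module _ (free : ClawNetFree G) where

    claw-free : ∀ {c a b d} → c ~ a → c ~ b → c ~ d → Apart a b → Apart a d → Apart b d → ⊥
    claw-free {c} {a} {b} {d} c~a c~b c~d a⊥b a⊥d b⊥d =
      proj₁ free (InducedCopy⇒HasInduced {f = lookup (c Vec.∷ a Vec.∷ b Vec.∷ d Vec.∷ Vec.[])}
        (from-yes (all? λ i → all? λ j → clawAdj i j ≟ᵇ clawAdj j i))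
        (from-yes (all? λ i → clawAdj i i ≟ᵇ false))
        ((c~a ∷ c~b ∷ c~d ∷ []) , (a⊥b ∷ a⊥d ∷ []) , (b⊥d ∷ []) , [] , tt))

    net-free : ∀ {t₀ t₁ t₂ p₀ p₁ p₂} →
      t₀ ~ t₁ → t₀ ~ t₂ → t₀ ~ p₀ → Apart t₀ p₁ → Apart t₀ p₂ →
      t₁ ~ t₂ → Apart t₁ p₀ → t₁ ~ p₁ → Apart t₁ p₂ →
      Apart t₂ p₀ → Apart t₂ p₁ → t₂ ~ p₂ →
      Apart p₀ p₁ → Apart p₀ p₂ →
      Apart p₁ p₂ → ⊥
    net-free {t₀} {t₁} {t₂} {p₀} {p₁} {p₂} r₀₁ r₀₂ r₀₃ r₀₄ r₀₅ r₁₂ r₁₃ r₁₄ r₁₅ r₂₃ r₂₄ r₂₅ r₃₄ r₃₅ r₄₅ =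
      proj₂ free (InducedCopy⇒HasInduced
        {f = lookup (t₀ Vec.∷ t₁ Vec.∷ t₂ Vec.∷ p₀ Vec.∷ p₁ Vec.∷ p₂ Vec.∷ Vec.[])}
        (from-yes (all? λ i → all? λ j → netAdj i j ≟ᵇ netAdj j i))
        (from-yes (all? λ i → netAdj i i ≟ᵇ false))
        ( (r₀₁ ∷ r₀₂ ∷ r₀₃ ∷ r₀₄ ∷ r₀₅ ∷ [])
        , (r₁₂ ∷ r₁₃ ∷ r₁₄ ∷ r₁₅ ∷ [])
        , (r₂₃ ∷ r₂₄ ∷ r₂₅ ∷ [])
        , (r₃₄ ∷ r₃₅ ∷ [])
        , (r₄₅ ∷ [])
        , [] , tt))

    advance-long : ∀ {X v₀ v₁ v₂ ps} → DominatingPath X v₀ (v₁ ∷ v₂ ∷ ps) → NextStart X v₀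
    advance-long dp@((((v₀~v₁ , v₀⊥v₂ ∷ _) , (v₁~v₂ , _) , _) , _) , _) with start-or-private dp
    ... | inj₁ next = next
    ... | inj₂ (y , (_ , y∉ , y~v₁ , y≁v₂ps) , y≁v₀) =
      ⊥-elim (claw-free (~-sym v₀~v₁) v₁~v₂ (~-sym y~v₁) v₀⊥v₂
                        (Apart-sym (∉∧≁⇒Apart y∉ (here refl) y≁v₀))
                        (Apart-sym (∉∧≁⇒Apart y∉ (there (there (here refl))) (y≁v₂ps ∘ here))))

    advance : ∀ {X v₀ v₁ ps} → DominatingPath X v₀ (v₁ ∷ ps) → NextStart X v₀
    advance {ps = _ ∷ _} dp = advance-long dp
    advance {ps = []}    dp with start-or-private dp
    ... | inj₁ next             = next
    ... | inj₂ (y , py , y≁v₀) = advance-long (extend-short dp py y≁v₀)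

    hamiltonian : ∀ {X v₀ ps} → Acc _<_ ∣ X ∣ → DominatingPath X v₀ ps → HamiltonianPathFrom X v₀
    hamiltonian {ps = []} _ dp = trivial-hamiltonian dp
    hamiltonian {ps = _ ∷ _} (acc rs) dp@((_ , v₀∈X ∷ _) , _) =
      let w , ws , v₀~w , dp′ = advance dp
      in  prepend v₀~w v₀∈X (hamiltonian (rs (x∈p⇒∣p-x∣<∣p∣ v₀∈X)) dp′)

    ~second⇒~last : ∀ {y u p q r} rs → InducedPath (p ∷ q ∷ r ∷ rs) → Escape y u (p ∷ q ∷ r ∷ rs) →
                               ¬ y ~ p → y ~ q → y ~head reverse (p ∷ q ∷ r ∷ rs)
    ~second⇒~last {y} {r = r} rs ((p~q , p⊥r ∷ _) , (q~r , _) , _) (y∉ , _) y≁p y~q with y ~? r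
    ... | no y≁r =
      ⊥-elim (claw-free (~-sym p~q) q~r (~-sym y~q) p⊥r (Apart-sym (∉∧≁⇒Apart y∉ (here refl) y≁p))
                        (Apart-sym (∉∧≁⇒Apart y∉ (there (there (here refl))) y≁r)))
    ~second⇒~last []       _ _ _ _ | yes y~r = y~r
    ~second⇒~last {y} (s ∷ _) ((p~q , p⊥r ∷ p⊥s ∷ _) , (q~r , q⊥s ∷ _) , (r~s , _) , _)
                             (y∉ , u~y , u⊥p ∷ u⊥q ∷ u⊥r ∷ u⊥s ∷ _) y≁p y~q | yes y~r with y ~? s
    ... | yes y~s = ⊥-elim (claw-free (~-sym u~y) y~q y~s u⊥q u⊥s q⊥s)
    ... | no  y≁s =
      -- the net: triangle y q r with pendant vertices u, p, s
      ⊥-elim (net-free y~q y~r (~-sym u~y) (∉∧≁⇒Apart y∉ (here refl) y≁p)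
                       (∉∧≁⇒Apart y∉ (there (there (there (here refl)))) y≁s)
                       q~r (Apart-sym u⊥q) (~-sym p~q) q⊥s
                       (Apart-sym u⊥r) (Apart-sym p⊥r) r~s
                       u⊥p u⊥s
                       p⊥s)

    ~tail⇒~last : ∀ {y u} p ps → InducedPath (p ∷ ps) → Escape y u (p ∷ ps) → ¬ y ~ p → Any (y ~_) ps →
                              y ~head reverse (p ∷ ps)
    ~tail⇒~last {y} p (q ∷ qs) path esc y≁p y~qqs with y ~? q
    ... | no y≁q =
      subst (y ~head_) (≡.sym (unfold-reverse p (q ∷ qs)))
            (~head-∷ʳ (reverse (q ∷ qs))
                      (~tail⇒~last q qs (proj₂ path) (Escape-tail esc) y≁q (Any.tail y≁q y~qqs)))
    ~tail⇒~last p (q ∷ [])     _    _   _   _ | yes y~q = y~q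
    ~tail⇒~last p (q ∷ r ∷ rs) path esc y≁p _ | yes y~q = ~second⇒~last rs path esc y≁p y~q

    ~P⇒~end : ∀ {y u} P → InducedPath P → Escape y u P → Any (y ~_) P → y ~head P ⊎ y ~head reverse P
    ~P⇒~end {y} (p ∷ ps) path esc y~P with y ~? p
    ... | yes y~p = inj₁ y~p
    ... | no  y≁p = inj₂ (~tail⇒~last p ps path esc y≁p (Any.tail y≁p y~P))

    extend-at-start : ∀ {X y u} P → InducedPathIn X P → y ∈ₛ X → u ∈ₛ X → Escape y u P → y ~head P →
                      Longer X (length P)
    extend-at-start {y = y} (v₀ ∷ ps) (path , inX) y∈X u∈X (y∉ , u~y , u⊥P) y~v₀ with Any.any? (y ~?_) ps
    ... | no y≁ps =
      _ ∷ y ∷ v₀ ∷ ps , (((u~y , u⊥P) , (y~v₀ , apart-all (y∉ ∘ there) y≁ps) , path) , u∈X ∷ y∈X ∷ inX) ,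
      s≤s (n≤1+n _)
    extend-at-start {y = y} (v₀ ∷ v₁ ∷ ps) ((v₀◃ , path) , _ ∷ inX) y∈X u∈X (y∉ , u~y , u⊥P) y~v₀ | yes y~v₁ps
      with Any.any? (y ~?_) ps
    ... | yes y~ps =
      let x , x∈ps , y~x = find y~ps
      in  ⊥-elim (claw-free (~-sym u~y) y~v₀ y~x (All.head u⊥P) (All.lookup u⊥P (there (there x∈ps)))
                            (All.lookup (proj₂ v₀◃) x∈ps))
    ... | no y≁ps =
      _ ∷ y ∷ v₁ ∷ ps ,
      (((u~y , All.tail u⊥P) , (Any.head y≁ps y~v₁ps , apart-all (y∉ ∘ there ∘ there) y≁ps) , path) , u∈X ∷ y∈X ∷ inX) ,
      ≤-refl

    lengthen-by-escape : ∀ {X y u} P → InducedPathIn X P → y ∈ₛ X → u ∈ₛ X → Escape y u P → Any (y ~_) P →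
                         Longer X (length P)
    lengthen-by-escape P (path , inX) y∈X u∈X esc y~P with ~P⇒~end P path esc y~P
    ... | inj₁ y~start = extend-at-start P (path , inX) y∈X u∈X esc y~start
    ... | inj₂ y~end   =
      subst (Longer _) (length-reverse P)
            (extend-at-start (reverse P) (InducedPath-reverse P path , All-reverse inX) y∈X u∈X (Escape-reverse esc) y~end)

    module _ {X : Subset (n G)} (connected : CutConnected X) where

      lengthen : ∀ {v₀ ps u} → InducedPathIn X (v₀ ∷ ps) → u ∈ₛ X → u ∉ v₀ ∷ ps → ¬ Any (u ~_) ps →
                 Longer X (length (v₀ ∷ ps))
      lengthen {v₀} {ps} {u} (path , inX) u∈X u∉P u≁ps with u ~? v₀
      ... | yes u~v₀ = u ∷ v₀ ∷ ps , (((u~v₀ , apart-all (u∉P ∘ there) u≁ps) , path) , u∈X ∷ inX) , ≤-refl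
      ... | no  u≁v₀ =
        let y , u′ , y∈X , u′∈X , y~u′ , y∈N , u′∉N =
              connected N[ P ]? (All.head inX) u∈X (inj₁ (here refl))
                        [ u∉P , [ u≁v₀ , u≁ps ]′ ∘ Any.toSum ]′
            y∉P : y ∉ P
            y∉P y∈P = u′∉N (inj₂ (lose y∈P (~-sym y~u′)))
        in  lengthen-by-escape P (path , inX) y∈X u′∈X
              (y∉P , ~-sym y~u′ , apart-all (u′∉N ∘ inj₁) (u′∉N ∘ inj₂))
              ([ ⊥-elim ∘ y∉P , id ]′ y∈N)
        where P = v₀ ∷ ps

      grow : ∀ {v₀ ps} → InducedPathIn X (v₀ ∷ ps) → Acc _<_ (∣ X ∣ ∸ length (v₀ ∷ ps)) →
             ∃₂ (DominatingPath X)
      grow {v₀} {ps} path (acc rs)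
        with any? (λ u → (u ∈ₛ? X) ×-dec ¬? (u ∈? (v₀ ∷ ps)) ×-dec ¬? (Any.any? (u ~?_) ps))
      ... | no none =
        v₀ , ps , path , λ {z} z∈X z∉P → decidable-stable (Any.any? (z ~?_) ps) λ z≁ps → none (z , z∈X , z∉P , z≁ps)
      ... | yes (u , u∈X , u∉P , u≁ps) with lengthen path u∈X u∉P u≁ps
      ...   | w ∷ ws , path′@(isInduced , inX) , longer =
        grow path′ (rs (∸-monoʳ-< longer (length≤∣p∣ (InducedPath⇒Unique _ isInduced) inX)))

      traceable : ∀ {v} → v ∈ₛ X → ∃ (HamiltonianPathFrom X)
      traceable v∈X =
        let v₀ , ps , dp = grow ((tt , tt) , v∈X ∷ []) (<-wellFounded _)
        in  v₀ , hamiltonian (<-wellFounded _) dp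

    hamiltonianPath : (H : Subgraph G) → Connected H → ∃ λ P → IsPath G P × (∀ {z} → z ∈ P ⇔ S H z ≡ true)
    hamiltonianPath H conn@((_ , Sv) , _) =
      let v₀ , Q , path , spans = traceable (Connected⇒CutConnected H conn) (∈-tabulate⁺ Sv)
      in  v₀ ∷ Q , path , mk⇔ (∈-tabulate⁻ ∘ to spans) (from spans ∘ ∈-tabulate⁺)

    linear⇒centered : ∀ {C : Set} {c : V → C} → IsLinear G c → IsCentered G c
    linear⇒centered linear H conn =
      let P , path , spans = hamiltonianPath H conn
          v , v∈P , v-unique = linear P path
      in  v , to spans v∈P , λ w w∈H cw≡cv → v-unique w (from spans w∈H) cw≡cv

  centered⇒linear : ∀ {C : Set} {c : V → C} → IsCentered G c → IsLinear G c
  centered⇒linear centered (p ∷ ps) (_ , linked) =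
    let v , v∈H , v-unique = centered (induced on-path) ((p , on-path⁺ (here refl)) , walk)
    in  v , on-path⁻ v∈H , λ w w∈P cw≡cv → v-unique w (on-path⁺ w∈P) cw≡cv
    where
    on-path : V → Bool
    on-path x = isYes (x ∈? (p ∷ ps))

    on-path⁺ : ∀ {x} → x ∈ p ∷ ps → on-path x ≡ true
    on-path⁺ {x} = to T-≡ ∘ fromWitness {a? = x ∈? (p ∷ ps)}

    on-path⁻ : ∀ {x} → on-path x ≡ true → x ∈ p ∷ ps
    on-path⁻ {x} = toWitness {a? = x ∈? (p ∷ ps)} ∘ from T-≡

    walk : ∀ a b → on-path a ≡ true → on-path b ≡ true → Walk (induced on-path) a b
    walk a b a∈ b∈ = reverseʷ (walk-along linked all-on (on-path⁻ a∈)) ++ʷ walk-along linked all-on (on-path⁻ b∈)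
      where all-on = All.tabulate on-path⁺

chromatic-numbers-agree : ∀ {G} → (∀ {C : Set} (c : Vertex G → C) → IsLinear G c ⇔ IsCentered G c) →
                          ∀ k → IsChiLin G k ⇔ IsChiCen G k
chromatic-numbers-agree same k =
  mk⇔ (λ ((c , linear) , least) → (c , to (same c) linear) , λ m c′ centered → least m c′ (from (same c′) centered))
      (λ ((c , centered) , least) → (c , from (same c) centered) , λ m c′ linear → least m c′ (to (same c′) linear))

proposition4p4 : (G : Graph) → ClawNetFree G →
    ((C : Set) (c : Vertex G → C) → IsLinear G c → IsCentered G c) ×
    ((k : ℕ) → IsChiLin G k ⇔ IsChiCen G k)
proposition4p4 G free =
  (λ _ _ → linear⇒centered free) ,
  chromatic-numbers-agree (λ c → mk⇔ (linear⇒centered free) centered⇒linear)
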